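{- For every prime $p$, $g_{(2,4,1,2)}(p)=p^5+3p^4-p^3-p^2$.
   Context: For a prime $p$ and a tuple $\alpha=(\alpha_1,\dots,\alpha_{n-1})$ of positive integers, an irreducible subring matrix with diagonal $\alpha$ is an $n\times n$ upper triangular integer matrix $A$ with $A_{ii}=p^{\alpha_i}$ for $1\le i\le n-1$, $A_{nn}=1$, $A_{in}=1$ for all $i$, and $A_{ij}=p\,a_{ij}$ with integers $0\le a_{ij}\le p^{\alpha_i-1}-1$ for $1\le i<j\le n-1$, such that the $\mathbb{Z}$-span of the columns of $A$ is closed under componentwise multiplication of vectors. $g_\alpha(p)$ denotes the number of irreducible subring matrices with diagonal $\alpha$ (here $n=5$). -}

module Defs where

open import Data.Nat as ℕ using (ℕ; suc; _∸_; _^_)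
open import Data.Integer as ℤ using (ℤ; +_; _+_; _*_)
open import Data.Fin using (Fin; toℕ; inject₁; fromℕ)
open import Data.Vec using (Vec; lookup; foldr′; zipWith; tabulate)
open import Data.Product using (Σ; ∃; _×_)
open import Relation.Binary.PropositionalEquality using (_≡_)

Matrix : ℕ → Set
Matrix m = Vec (Vec ℤ m) m

entry : ∀ {m} → Matrix m → Fin m → Fin m → ℤ
entry A i j = lookup (lookup A i) j

ZVec : ℕ → Set
ZVec m = Fin m → ℤ

combo : ∀ {m} → Matrix m → ZVec m → ZVec m
combo A c i = foldr′ _+_ (+ 0) (zipWith _*_ (lookup A i) (tabulate c))

InColSpan : ∀ {m} → Matrix m → ZVec m → Set
InColSpan A v = ∃ λ c → ∀ i → v i ≡ combo A c i

_⊙_ : ∀ {m} → ZVec m → ZVec m → ZVec m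
(u ⊙ v) i = u i * v i

ColSpanMulClosed : ∀ {m} → Matrix m → Set
ColSpanMulClosed A = ∀ u v → InColSpan A u → InColSpan A v → InColSpan A (u ⊙ v)

-- Irreducible subring matrix of size (n+1) × (n+1) with diagonal α = (α_1,…,α_n).
-- Index k : Fin n corresponds to row/column inject₁ k; the last index is fromℕ n.
record IsIrredSubringMatrix (p n : ℕ) (α : Vec ℕ n) (A : Matrix (suc n)) : Set where
  field
    upperTriangular : ∀ i j → toℕ j ℕ.< toℕ i → entry A i j ≡ + 0
    diagonal        : ∀ k → entry A (inject₁ k) (inject₁ k) ≡ + (p ^ lookup α k)
    lastColumn      : ∀ i → entry A i (fromℕ n) ≡ + 1
    offDiagonal     : ∀ k l → toℕ k ℕ.< toℕ l →
                        ∃ λ a → (a ℕ.< p ^ (lookup α k ∸ 1)) ×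
                                (entry A (inject₁ k) (inject₁ l) ≡ + (p ℕ.* a))
    subring         : ColSpanMulClosed A

module Submission where

-- Let c₁, …, c₅ be the columns of such a matrix and L their ℤ-span. Because
-- multiplication is bilinear, L is a ring as soon as every product cᵢcⱼ lies
-- in L. For the diagonal (p², p⁴, p, p², 1) all products are in L except
-- possibly c₃², c₃c₄ and c₄²; back-substitution shows that these lie in L iff
-- e ∈ p²ℤ with p ∣ a₁₂·e/p² for e = a₂₃² − a₂₃, a₂₃a₂₄ and a₂₄² − p·a₂₄, while
-- a₁₃ and a₁₄ are unconstrained. Since a(a − 1) ≡ 0 modulo a prime power
-- forces a ≡ 0 or 1, these conditions cut out five explicit families of
-- triples (a₁₂, a₂₃, a₂₄): two with a₁₂ = 0, of sizes p³ and p², and three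
-- with p ∤ a₁₂, of sizes p(p − 1), p(p − 1) and p − 1. Multiplying by the p²
-- choices of (a₁₃, a₁₄) gives p⁵ + 3p⁴ − p³ − p².

open import Defs
open import Data.Nat using (ℕ)
open import Data.Nat.Primality using (Prime)

module ColumnSpans where

  open import Data.Integer using (ℤ; +_; _+_; _*_)
  import Data.Integer.Properties as ℤ
  open import Algebra.Properties.CommutativeSemigroup ℤ.*-commutativeSemigroup using (x∙yz≈y∙xz)
  open import Algebra.Properties.Semiring.Sum ℤ.+-*-semiring
    using (sum; sum-syntax; ∑-comm; sum-cong-≗; *-distribˡ-sum; *-distribʳ-sum)
  open import Data.Fin using (Fin; zero; suc)
  open import Data.Vec using (Vec; _∷_; []; lookup; foldr′; zipWith; tabulate)
  open import Data.Product using (_,_; proj₁; proj₂)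
  open import Function.Bundles using (_⇔_; mk⇔)
  open import Relation.Binary.PropositionalEquality

  col : ∀ {m} → Matrix m → Fin m → ZVec m
  col A j i = entry A i j

  basis : ∀ {m} → Fin m → ZVec m
  basis zero    zero    = + 1
  basis zero    (suc k) = + 0
  basis (suc j) zero    = + 0
  basis (suc j) (suc k) = basis j k

  combo≡∑ : ∀ {m} (A : Matrix m) c i → combo A c i ≡ ∑[ j < m ] (entry A i j * c j)
  combo≡∑ A c i = row≡∑ (lookup A i) c
    where
    row≡∑ : ∀ {m} (r : Vec ℤ m) (c : ZVec m) →
            foldr′ _+_ (+ 0) (zipWith _*_ r (tabulate c)) ≡ ∑[ j < m ] (lookup r j * c j)
    row≡∑ []      c = refl
    row≡∑ (x ∷ r) c = cong (_+_ (x * c zero)) (row≡∑ r (λ j → c (suc j)))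

  ∑-*-zeroʳ : ∀ {m} (f : Fin m → ℤ) → ∑[ k < m ] (f k * + 0) ≡ + 0
  ∑-*-zeroʳ f = trans (sym (*-distribʳ-sum (+ 0) f)) (ℤ.*-zeroʳ (sum f))

  ∑-*-basis : ∀ {m} (r : Vec ℤ m) j → ∑[ k < m ] (lookup r k * basis j k) ≡ lookup r j
  ∑-*-basis (x ∷ r) zero    = trans (cong₂ _+_ (ℤ.*-identityʳ x) (∑-*-zeroʳ (lookup r))) (ℤ.+-identityʳ x)
  ∑-*-basis (x ∷ r) (suc j) = trans (cong₂ _+_ (ℤ.*-zeroʳ x) (∑-*-basis r j)) (ℤ.+-identityˡ (lookup r j))

  col∈colSpan : ∀ {m} (A : Matrix m) j → InColSpan A (col A j)
  col∈colSpan A j = basis j , λ i → sym (trans (combo≡∑ A (basis j) i) (∑-*-basis (lookup A i) j))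

  InColSpan-resp-≗ : ∀ {m} {A : Matrix m} {u v : ZVec m} → (∀ i → u i ≡ v i) → InColSpan A u → InColSpan A v
  InColSpan-resp-≗ u≗v (c , u≡Ac) = c , λ i → trans (sym (u≗v i)) (u≡Ac i)

  col⊙col-comm : ∀ {m} (A : Matrix m) {j k} → InColSpan A (col A j ⊙ col A k) → InColSpan A (col A k ⊙ col A j)
  col⊙col-comm A {j} {k} = InColSpan-resp-≗ {A = A} (λ i → ℤ.*-comm (entry A i j) (entry A i k))

  InColSpan-∑ : ∀ {m n} {A : Matrix m} (x : Fin n → ℤ) (w : Fin n → ZVec m) →
                (∀ j → InColSpan A (w j)) → InColSpan A (λ i → ∑[ j < n ] (x j * w j i))
  InColSpan-∑ {m} {n} {A} x w w∈ = c , w≡Ac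
    where
    e : Fin n → ZVec m
    e j = proj₁ (w∈ j)
    c : ZVec m
    c k = ∑[ j < n ] (x j * e j k)
    w≡Ae : ∀ j i → w j i ≡ ∑[ k < m ] (entry A i k * e j k)
    w≡Ae j i = trans (proj₂ (w∈ j) i) (combo≡∑ A (e j) i)
    w≡Ac : ∀ i → ∑[ j < n ] (x j * w j i) ≡ combo A c i
    w≡Ac i = begin
      ∑[ j < n ] (x j * w j i)                             ≡⟨ sum-cong-≗ (λ j → cong (x j *_) (w≡Ae j i)) ⟩
      ∑[ j < n ] (x j * ∑[ k < m ] (entry A i k * e j k))  ≡⟨ sum-cong-≗ (λ j → *-distribˡ-sum (x j) (λ k → entry A i k * e j k)) ⟩
      ∑[ j < n ] ∑[ k < m ] (x j * (entry A i k * e j k))  ≡⟨ ∑-comm (λ j k → x j * (entry A i k * e j k)) ⟩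
      ∑[ k < m ] ∑[ j < n ] (x j * (entry A i k * e j k))
        ≡⟨ sum-cong-≗ (λ k → sum-cong-≗ (λ j → x∙yz≈y∙xz (x j) (entry A i k) (e j k))) ⟩
      ∑[ k < m ] ∑[ j < n ] (entry A i k * (x j * e j k))  ≡⟨ sum-cong-≗ (λ k → *-distribˡ-sum (entry A i k) (λ j → x j * e j k)) ⟨
      ∑[ k < m ] (entry A i k * c k)                       ≡⟨ combo≡∑ A c i ⟨
      combo A c i                                          ∎
      where open ≡-Reasoning

  colSpanMulClosed⇔ : ∀ {m} (A : Matrix m) → ColSpanMulClosed A ⇔ (∀ j k → InColSpan A (col A j ⊙ col A k))
  colSpanMulClosed⇔ {m} A = mk⇔ (λ closed j k → closed _ _ (col∈colSpan A j) (col∈colSpan A k)) fromColumns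
    where
    fromColumns : (∀ j k → InColSpan A (col A j ⊙ col A k)) → ColSpanMulClosed A
    fromColumns products u v (c , u≡Ac) (d , v≡Ad) =
      InColSpan-resp-≗ {A = A} expand (InColSpan-∑ {A = A} c (λ j → col A j ⊙ v) colj⊙v∈)
      where
      colj⊙v∈ : ∀ j → InColSpan A (col A j ⊙ v)
      colj⊙v∈ j = InColSpan-resp-≗ {A = A} expandʳ (InColSpan-∑ {A = A} d (λ k → col A j ⊙ col A k) (products j))
        where
        expandʳ : ∀ i → ∑[ k < m ] (d k * (entry A i j * entry A i k)) ≡ entry A i j * v i
        expandʳ i = begin
          ∑[ k < m ] (d k * (entry A i j * entry A i k))  ≡⟨ sum-cong-≗ (λ k → x∙yz≈y∙xz (d k) (entry A i j) (entry A i k)) ⟩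
          ∑[ k < m ] (entry A i j * (d k * entry A i k))  ≡⟨ sum-cong-≗ (λ k → cong (entry A i j *_) (ℤ.*-comm (d k) (entry A i k))) ⟩
          ∑[ k < m ] (entry A i j * (entry A i k * d k))  ≡⟨ *-distribˡ-sum (entry A i j) (λ k → entry A i k * d k) ⟨
          entry A i j * ∑[ k < m ] (entry A i k * d k)    ≡⟨ cong (entry A i j *_) (trans (v≡Ad i) (combo≡∑ A d i)) ⟨
          entry A i j * v i                               ∎
          where open ≡-Reasoning
      expand : ∀ i → ∑[ j < m ] (c j * (entry A i j * v i)) ≡ u i * v i
      expand i = begin
        ∑[ j < m ] (c j * (entry A i j * v i))
          ≡⟨ sum-cong-≗ (λ j → trans (sym (ℤ.*-assoc (c j) (entry A i j) (v i))) (cong (_* v i) (ℤ.*-comm (c j) (entry A i j)))) ⟩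
        ∑[ j < m ] (entry A i j * c j * v i)    ≡⟨ *-distribʳ-sum (v i) (λ j → entry A i j * c j) ⟨
        (∑[ j < m ] (entry A i j * c j)) * v i  ≡⟨ cong (_* v i) (trans (u≡Ac i) (combo≡∑ A c i)) ⟨
        u i * v i                               ∎
        where open ≡-Reasoning

module CandidateMatrices where

  open ColumnSpans
  open import Data.Integer using (ℤ; +_; _+_; _*_; _-_; NonZero)
  import Data.Integer.Properties as ℤ
  open import Data.Integer.Tactic.RingSolver using (solve-∀)
  open import Data.Fin.Patterns using (0F; 1F; 2F; 3F; 4F)
  open import Data.Vec using (_∷_; [])
  open import Data.Product using (∃; _×_; _,_)
  open import Function.Bundles using (_⇔_; mk⇔; Equivalence)
  open import Relation.Binary.PropositionalEquality

  ≡-by-difference : ∀ k {u w a b : ℤ} → .{{NonZero k}} → u - w ≡ k * (a - b) → u ≡ w ⇔ a ≡ b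
  ≡-by-difference k {u} {w} {a} {b} d = mk⇔
    (λ u≡w → ℤ.i-j≡0⇒i≡j a b (ℤ.*-cancelˡ-≡ k (a - b) (+ 0)
                (trans (sym d) (trans (ℤ.i≡j⇒i-j≡0 u≡w) (sym (ℤ.*-zeroʳ k))))))
    (λ a≡b → ℤ.i-j≡0⇒i≡j u w (trans d (trans (cong (k *_) (ℤ.i≡j⇒i-j≡0 a≡b)) (ℤ.*-zeroʳ k))))

  -- Entries and columns are named with the paper's 1-based indices (a₁₂, c₃, …),
  -- while Fin positions are 0-based: column c₃ is col A 2F.
  candidate : (P a₁₂ a₁₃ a₁₄ a₂₃ a₂₄ : ℤ) → Matrix 5
  candidate P a₁₂ a₁₃ a₁₄ a₂₃ a₂₄ =
    (P * P ∷ P * a₁₂         ∷ P * a₁₃ ∷ P * a₁₄ ∷ + 1 ∷ []) ∷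
    (+ 0   ∷ P * P * (P * P) ∷ P * a₂₃ ∷ P * a₂₄ ∷ + 1 ∷ []) ∷
    (+ 0   ∷ + 0             ∷ P       ∷ + 0     ∷ + 1 ∷ []) ∷
    (+ 0   ∷ + 0             ∷ + 0     ∷ P * P   ∷ + 1 ∷ []) ∷
    (+ 0   ∷ + 0             ∷ + 0     ∷ + 0     ∷ + 1 ∷ []) ∷ []

  record Admissible (P a₁₂ e : ℤ) : Set where
    field
      q r     : ℤ
      e≡P²q   : e ≡ P * P * q
      a₁₂q≡Pr : a₁₂ * q ≡ P * r

  ClosureConditions : (P a₁₂ a₂₃ a₂₄ : ℤ) → Set
  ClosureConditions P a₁₂ a₂₃ a₂₄ =
    Admissible P a₁₂ (a₂₃ * a₂₃ - a₂₃) ×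
    Admissible P a₁₂ (a₂₃ * a₂₄) ×
    Admissible P a₁₂ (a₂₄ * a₂₄ - P * a₂₄)

  private
    combo-row₁ : ∀ P a b c x y z t u →
      P * P * x + (P * a * y + (P * b * z + (P * c * t + (+ 1 * u + + 0))))
        ≡ x * (P * P) + y * (P * a) + z * (P * b) + t * (P * c) + u
    combo-row₁ = solve-∀
    combo-row₂ : ∀ P a b x y z t u →
      + 0 * x + (P * P * (P * P) * y + (P * a * z + (P * b * t + (+ 1 * u + + 0))))
        ≡ y * (P * P * (P * P)) + z * (P * a) + t * (P * b) + u
    combo-row₂ = solve-∀
    combo-row₃ : ∀ P x y z t u → + 0 * x + (+ 0 * y + (P * z + (+ 0 * t + (+ 1 * u + + 0)))) ≡ z * P + u
    combo-row₃ = solve-∀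
    combo-row₄ : ∀ P x y z t u → + 0 * x + (+ 0 * y + (+ 0 * z + (P * P * t + (+ 1 * u + + 0)))) ≡ t * (P * P) + u
    combo-row₄ = solve-∀
    combo-row₅ : ∀ x y z t u → + 0 * x + (+ 0 * y + (+ 0 * z + (+ 0 * t + (+ 1 * u + + 0)))) ≡ u
    combo-row₅ = solve-∀

    c₁-multiple : ∀ P X → P * P * X ≡ X * (P * P) + + 0 + + 0 + + 0
    c₁-multiple = solve-∀
    c₂c₂-row₁ : ∀ P a → P * a * (P * a) ≡ (a * a - P * P * P * a) * (P * P) + P * P * (P * P) * (P * a) + + 0 + + 0
    c₂c₂-row₁ = solve-∀
    c₂c₂-row₂ : ∀ P → P * P * (P * P) * (P * P * (P * P)) ≡ P * P * (P * P) * (P * P * (P * P)) + + 0 + + 0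
    c₂c₂-row₂ = solve-∀
    c₂c-row₁ : ∀ P a b c → P * a * (P * b) ≡ (a * b - a * c) * (P * P) + P * c * (P * a) + + 0 + + 0
    c₂c-row₁ = solve-∀
    c₂c-row₂ : ∀ P c → P * P * (P * P) * (P * c) ≡ P * c * (P * P * (P * P)) + + 0 + + 0
    c₂c-row₂ = solve-∀
    c₃c₃-row₁ : ∀ P a₁₂ a₁₃ a₁₄ x y →
      P * a₁₃ * (P * a₁₃) - (x * (P * P) + y * (P * a₁₂) + P * (P * a₁₃) + + 0 * (P * a₁₄))
        ≡ P * (P * (a₁₃ * a₁₃ - a₁₃ - x) - a₁₂ * y)
    c₃c₃-row₁ = solve-∀
    c₃c₃-row₂ : ∀ P a₂₃ a₂₄ y →
      P * a₂₃ * (P * a₂₃) - (y * (P * P * (P * P)) + P * (P * a₂₃) + + 0 * (P * a₂₄))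
        ≡ P * P * (a₂₃ * a₂₃ - a₂₃ - P * P * y)
    c₃c₃-row₂ = solve-∀
    c₃c₄-row₁ : ∀ P a₁₂ a₁₃ a₁₄ x y →
      P * a₁₃ * (P * a₁₄) - (x * (P * P) + y * (P * a₁₂) + + 0 * (P * a₁₃) + + 0 * (P * a₁₄))
        ≡ P * (P * (a₁₃ * a₁₄ - x) - a₁₂ * y)
    c₃c₄-row₁ = solve-∀
    c₃c₄-row₂ : ∀ P a₂₃ a₂₄ y →
      P * a₂₃ * (P * a₂₄) - (y * (P * P * (P * P)) + + 0 * (P * a₂₃) + + 0 * (P * a₂₄))
        ≡ P * P * (a₂₃ * a₂₄ - P * P * y)
    c₃c₄-row₂ = solve-∀
    c₄c₄-row₁ : ∀ P a₁₂ a₁₃ a₁₄ x y →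
      P * a₁₄ * (P * a₁₄) - (x * (P * P) + y * (P * a₁₂) + + 0 * (P * a₁₃) + P * P * (P * a₁₄))
        ≡ P * (P * (a₁₄ * a₁₄ - P * a₁₄ - x) - a₁₂ * y)
    c₄c₄-row₁ = solve-∀
    c₄c₄-row₂ : ∀ P a₂₃ a₂₄ y →
      P * a₂₄ * (P * a₂₄) - (y * (P * P * (P * P)) + + 0 * (P * a₂₃) + P * P * (P * a₂₄))
        ≡ P * P * (a₂₄ * a₂₄ - P * a₂₄ - P * P * y)
    c₄c₄-row₂ = solve-∀

  module Candidate (P a₁₂ a₁₃ a₁₄ a₂₃ a₂₄ : ℤ) where

    A : Matrix 5
    A = candidate P a₁₂ a₁₃ a₁₄ a₂₃ a₂₄

    -- v = x c₁ + y c₂ + z c₃ + t c₄, row by row. The coefficients stand on the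
    -- left because + 0 * n reduces to + 0 while n * + 0 does not.
    Combination : ZVec 5 → (x y z t : ℤ) → Set
    Combination v x y z t =
      v 0F ≡ x * (P * P) + y * (P * a₁₂) + z * (P * a₁₃) + t * (P * a₁₄) ×
      v 1F ≡ y * (P * P * (P * P)) + z * (P * a₂₃) + t * (P * a₂₄) ×
      v 2F ≡ z * P ×
      v 3F ≡ t * (P * P)

    InColSpan⇔Combination : ∀ {v} → v 4F ≡ + 0 →
      InColSpan A v ⇔ ∃ λ x → ∃ λ y → ∃ λ z → ∃ λ t → Combination v x y z t
    InColSpan⇔Combination {v} v₅≡0 = mk⇔ to from
      where
      to : InColSpan A v → ∃ λ x → ∃ λ y → ∃ λ z → ∃ λ t → Combination v x y z t
      to (w , v≡Aw) = x , y , z , t ,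
        row (v≡Aw 0F) (combo-row₁ P a₁₂ a₁₃ a₁₄ x y z t u) , row (v≡Aw 1F) (combo-row₂ P a₂₃ a₂₄ x y z t u) ,
        row (v≡Aw 2F) (combo-row₃ P x y z t u) , row (v≡Aw 3F) (combo-row₄ P x y z t u)
        where
        x y z t u : ℤ
        x = w 0F ; y = w 1F ; z = w 2F ; t = w 3F ; u = w 4F
        u≡0 : u ≡ + 0
        u≡0 = trans (sym (combo-row₅ x y z t u)) (trans (sym (v≡Aw 4F)) v₅≡0)
        row : ∀ {a b c} → a ≡ b → b ≡ c + u → a ≡ c
        row {c = c} a≡b b≡c+u = trans a≡b (trans b≡c+u (trans (cong (_+_ c) u≡0) (ℤ.+-identityʳ c)))
      from : (∃ λ x → ∃ λ y → ∃ λ z → ∃ λ t → Combination v x y z t) → InColSpan A v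
      from (x , y , z , t , r₁ , r₂ , r₃ , r₄) = w , λ where
          0F → row r₁ (combo-row₁ P a₁₂ a₁₃ a₁₄ x y z t (+ 0))
          1F → row r₂ (combo-row₂ P a₂₃ a₂₄ x y z t (+ 0))
          2F → row r₃ (combo-row₃ P x y z t (+ 0))
          3F → row r₄ (combo-row₄ P x y z t (+ 0))
          4F → trans v₅≡0 (sym (combo-row₅ x y z t (+ 0)))
        where
        w : ZVec 5
        w = λ { 0F → x ; 1F → y ; 2F → z ; 3F → t ; 4F → + 0 }
        row : ∀ {a b c} → a ≡ c → b ≡ c + + 0 → a ≡ b
        row {c = c} a≡c b≡c+0 = trans a≡c (sym (trans b≡c+0 (ℤ.+-identityʳ c)))

    combination : ∀ {v} x y → v 4F ≡ + 0 → Combination v x y (+ 0) (+ 0) → InColSpan A v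
    combination x y v₅≡0 rows = Equivalence.from (InColSpan⇔Combination v₅≡0) (x , y , + 0 , + 0 , rows)

    c₅≡1 : ∀ i → entry A i 4F ≡ + 1
    c₅≡1 0F = refl
    c₅≡1 1F = refl
    c₅≡1 2F = refl
    c₅≡1 3F = refl
    c₅≡1 4F = refl

    c⊙c₅∈span : ∀ j → InColSpan A (col A j ⊙ col A 4F)
    c⊙c₅∈span j = InColSpan-resp-≗ {A = A}
      (λ i → sym (trans (cong (entry A i j *_) (c₅≡1 i)) (ℤ.*-identityʳ (entry A i j)))) (col∈colSpan A j)

    module _ .{{P≢0 : NonZero P}} where

      private instance
        P²≢0 : NonZero (P * P)
        P²≢0 = ℤ.i*j≢0 P P

      -- Rows 3–5 pin down the coefficients of c₃, c₄, c₅; rows 2 and 1 then say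
      -- exactly that e₁ = P² y and P (e₀ − x) = a₁₂ y.
      product∈span⇔ : ∀ {v} e₀ e₁ z t → v 4F ≡ + 0 → v 2F ≡ z * P → v 3F ≡ t * (P * P) →
        (∀ x y → v 0F - (x * (P * P) + y * (P * a₁₂) + z * (P * a₁₃) + t * (P * a₁₄)) ≡ P * (P * (e₀ - x) - a₁₂ * y)) →
        (∀ y → v 1F - (y * (P * P * (P * P)) + z * (P * a₂₃) + t * (P * a₂₄)) ≡ P * P * (e₁ - P * P * y)) →
        InColSpan A v ⇔ Admissible P a₁₂ e₁
      product∈span⇔ {v} e₀ e₁ z t v₅≡0 v₃≡zP v₄≡tP² row₁ row₂ = mk⇔ to from
        where
        to : InColSpan A v → Admissible P a₁₂ e₁
        to v∈ with Equivalence.to (InColSpan⇔Combination v₅≡0) v∈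
        ... | x , y , z′ , t′ , r₁ , r₂ , r₃ , r₄
          with ℤ.*-cancelʳ-≡ z′ z P (trans (sym r₃) v₃≡zP) | ℤ.*-cancelʳ-≡ t′ t (P * P) (trans (sym r₄) v₄≡tP²)
        ... | refl | refl = record
          { q = y ; r = e₀ - x
          ; e≡P²q = Equivalence.to (≡-by-difference (P * P) (row₂ y)) r₂
          ; a₁₂q≡Pr = sym (Equivalence.to (≡-by-difference P (row₁ x y)) r₁) }
        from : Admissible P a₁₂ e₁ → InColSpan A v
        from adm = Equivalence.from (InColSpan⇔Combination v₅≡0)
          (e₀ - r , q , z , t ,
           Equivalence.from (≡-by-difference P (row₁ (e₀ - r) q)) (trans (cong (P *_) (a-[a-b]≡b e₀ r)) (sym a₁₂q≡Pr)) ,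
           Equivalence.from (≡-by-difference (P * P) (row₂ q)) e≡P²q ,
           v₃≡zP , v₄≡tP²)
          where
          open Admissible adm
          a-[a-b]≡b : ∀ a b → a - (a - b) ≡ b
          a-[a-b]≡b = solve-∀

      c₃c₃⇔ : InColSpan A (col A 2F ⊙ col A 2F) ⇔ Admissible P a₁₂ (a₂₃ * a₂₃ - a₂₃)
      c₃c₃⇔ = product∈span⇔ (a₁₃ * a₁₃ - a₁₃) (a₂₃ * a₂₃ - a₂₃) P (+ 0) refl refl refl
                (c₃c₃-row₁ P a₁₂ a₁₃ a₁₄) (c₃c₃-row₂ P a₂₃ a₂₄)

      c₃c₄⇔ : InColSpan A (col A 2F ⊙ col A 3F) ⇔ Admissible P a₁₂ (a₂₃ * a₂₄)
      c₃c₄⇔ = product∈span⇔ (a₁₃ * a₁₄) (a₂₃ * a₂₄) (+ 0) (+ 0) refl (ℤ.*-zeroʳ P) refl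
                (c₃c₄-row₁ P a₁₂ a₁₃ a₁₄) (c₃c₄-row₂ P a₂₃ a₂₄)

      c₄c₄⇔ : InColSpan A (col A 3F ⊙ col A 3F) ⇔ Admissible P a₁₂ (a₂₄ * a₂₄ - P * a₂₄)
      c₄c₄⇔ = product∈span⇔ (a₁₄ * a₁₄ - P * a₁₄) (a₂₄ * a₂₄ - P * a₂₄) (+ 0) (P * P) refl refl refl
                (c₄c₄-row₁ P a₁₂ a₁₃ a₁₄) (c₄c₄-row₂ P a₂₃ a₂₄)

      column-products : ClosureConditions P a₁₂ a₂₃ a₂₄ → ∀ j k → InColSpan A (col A j ⊙ col A k)
      column-products cc j  4F = c⊙c₅∈span j
      column-products cc 4F k  = col⊙col-comm A (c⊙c₅∈span k)
      column-products cc 0F k  = combination (entry A 0F k) (+ 0) refl (c₁-multiple P (entry A 0F k) , refl , refl , refl)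
      column-products cc 1F 1F = combination (a₁₂ * a₁₂ - P * P * P * a₁₂) (P * P * (P * P)) refl
                                   (c₂c₂-row₁ P a₁₂ , c₂c₂-row₂ P , refl , refl)
      column-products cc 1F 2F = combination (a₁₂ * a₁₃ - a₁₂ * a₂₃) (P * a₂₃) refl
                                   (c₂c-row₁ P a₁₂ a₁₃ a₂₃ , c₂c-row₂ P a₂₃ , refl , refl)
      column-products cc 1F 3F = combination (a₁₂ * a₁₄ - a₁₂ * a₂₄) (P * a₂₄) refl
                                   (c₂c-row₁ P a₁₂ a₁₄ a₂₄ , c₂c-row₂ P a₂₄ , refl , refl)
      column-products (c₃c₃ , _ , _) 2F 2F = Equivalence.from c₃c₃⇔ c₃c₃
      column-products (_ , c₃c₄ , _) 2F 3F = Equivalence.from c₃c₄⇔ c₃c₄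
      column-products (_ , _ , c₄c₄) 3F 3F = Equivalence.from c₄c₄⇔ c₄c₄
      column-products cc 1F 0F = col⊙col-comm A (column-products cc 0F 1F)
      column-products cc 2F 0F = col⊙col-comm A (column-products cc 0F 2F)
      column-products cc 2F 1F = col⊙col-comm A (column-products cc 1F 2F)
      column-products cc 3F 0F = col⊙col-comm A (column-products cc 0F 3F)
      column-products cc 3F 1F = col⊙col-comm A (column-products cc 1F 3F)
      column-products cc 3F 2F = col⊙col-comm A (column-products cc 2F 3F)

      colSpanMulClosed⇔ClosureConditions : ColSpanMulClosed A ⇔ ClosureConditions P a₁₂ a₂₃ a₂₄
      colSpanMulClosed⇔ClosureConditions = mk⇔ closed⇒conditions (λ cc → Equivalence.from (colSpanMulClosed⇔ A) (column-products cc))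
        where
        closed⇒conditions : ColSpanMulClosed A → ClosureConditions P a₁₂ a₂₃ a₂₄
        closed⇒conditions closed =
          Equivalence.to c₃c₃⇔ (products 2F 2F) , Equivalence.to c₃c₄⇔ (products 2F 3F) , Equivalence.to c₄c₄⇔ (products 3F 3F)
          where
          products : ∀ j k → InColSpan A (col A j ⊙ col A k)
          products = Equivalence.to (colSpanMulClosed⇔ A) closed

module PrimePowers {p : ℕ} (p-prime : Prime p) where

  open import Data.Nat using (zero; suc; _*_; _^_; _∸_; NonZero; nonTrivial⇒≢1)
  open import Data.Nat.Properties using (*-comm; *-assoc; +-comm; *-identityʳ)
  open import Data.Nat.Divisibility
  open import Data.Nat.Primality using (euclidsLemma; prime⇒nonTrivial; prime⇒nonZero)
  open import Data.Empty using (⊥-elim)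
  open import Data.Sum using (_⊎_; inj₁; inj₂)
  open import Data.Product using (∃; _,_)
  open import Relation.Nullary using (¬_)
  open import Relation.Binary.PropositionalEquality

  private instance
    p≢0 : NonZero p
    p≢0 = prime⇒nonZero p-prime

  private
    j*p^1≡p*j : ∀ j → j * p ^ 1 ≡ p * j
    j*p^1≡p*j j = trans (cong (j *_) (*-identityʳ p)) (*-comm j p)

  ∣n⇒∤1+n : ∀ {n} → p ∣ n → ¬ p ∣ suc n
  ∣n⇒∤1+n {n} p∣n p∣1+n = nonTrivial⇒≢1 {{prime⇒nonTrivial p-prime}}
    (∣1⇒≡1 (∣m+n∣m⇒∣n (subst (p ∣_) (+-comm 1 n) p∣1+n) p∣n))

  ∤m∧^∣m*n⇒^∣n : ∀ {m} → ¬ p ∣ m → ∀ k n → p ^ k ∣ m * n → p ^ k ∣ n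
  ∤m∧^∣m*n⇒^∣n p∤m zero n _ = 1∣ n
  ∤m∧^∣m*n⇒^∣n {m} p∤m (suc k) n pᵏ⁺¹∣mn with euclidsLemma m n p-prime (∣-trans (m∣m*n (p ^ k)) pᵏ⁺¹∣mn)
  ... | inj₁ p∣m = ⊥-elim (p∤m p∣m)
  ... | inj₂ (divides n′ refl) = subst (p ^ suc k ∣_) (*-comm p n′)
    (*-monoʳ-∣ p (∤m∧^∣m*n⇒^∣n p∤m k n′ (*-cancelˡ-∣ p (subst (p ^ suc k ∣_) m*[n′*p]≡p*[m*n′] pᵏ⁺¹∣mn))))
    where
    m*[n′*p]≡p*[m*n′] : m * (n′ * p) ≡ p * (m * n′)
    m*[n′*p]≡p*[m*n′] = trans (cong (m *_) (*-comm n′ p))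
      (trans (sym (*-assoc m p n′)) (trans (cong (_* n′) (*-comm m p)) (*-assoc p m n′)))

  ^∣consecutive : ∀ k n → p ^ k ∣ suc n * n → p ^ k ∣ suc n ⊎ p ^ k ∣ n
  ^∣consecutive zero    n _ = inj₁ (1∣ _)
  ^∣consecutive (suc k) n pᵏ⁺¹∣ with euclidsLemma (suc n) n p-prime (∣-trans (m∣m*n (p ^ k)) pᵏ⁺¹∣)
  ... | inj₁ p∣1+n = inj₁ (∤m∧^∣m*n⇒^∣n (λ p∣n → ∣n⇒∤1+n p∣n p∣1+n) (suc k) (suc n)
                            (subst (p ^ suc k ∣_) (*-comm (suc n) n) pᵏ⁺¹∣))
  ... | inj₂ p∣n   = inj₂ (∤m∧^∣m*n⇒^∣n (∣n⇒∤1+n p∣n) (suc k) n pᵏ⁺¹∣)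

  idempotent-mod-^ : ∀ k a → p ^ k ∣ a * (a ∸ 1) → (∃ λ j → a ≡ j * p ^ k) ⊎ (∃ λ j → a ≡ suc (j * p ^ k))
  idempotent-mod-^ k zero    _ = inj₁ (0 , refl)
  idempotent-mod-^ k (suc n) pᵏ∣ with ^∣consecutive k n pᵏ∣
  ... | inj₁ (divides j 1+n≡jpᵏ) = inj₁ (j , 1+n≡jpᵏ)
  ... | inj₂ (divides j n≡jpᵏ)   = inj₂ (j , cong suc n≡jpᵏ)

  ∤m∧∣m*n⇒∣n : ∀ {m n} → ¬ p ∣ m → p ∣ m * n → p ∣ n
  ∤m∧∣m*n⇒∣n {m} {n} p∤m p∣mn with euclidsLemma m n p-prime p∣mn
  ... | inj₁ p∣m = ⊥-elim (p∤m p∣m)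
  ... | inj₂ p∣n = p∣n

  idempotent-mod-p : ∀ m → p ∣ m * (m ∸ 1) → (∃ λ j → m ≡ p * j) ⊎ (∃ λ j → m ≡ suc (p * j))
  idempotent-mod-p m p∣ with idempotent-mod-^ 1 m (subst (_∣ m * (m ∸ 1)) (sym (*-identityʳ p)) p∣)
  ... | inj₁ (j , m≡jp)   = inj₁ (j , trans m≡jp (j*p^1≡p*j j))
  ... | inj₂ (j , m≡1+jp) = inj₂ (j , trans m≡1+jp (cong suc (j*p^1≡p*j j)))

module NaturalConditions where

  open CandidateMatrices using (Admissible; ClosureConditions)
  open import Data.Nat as ℕ using (zero; suc; _∸_; NonZero)
  import Data.Nat.Properties as ℕ
  open import Data.Nat.Divisibility using (_∣_; divides)
  open import Data.Nat.Primality using (euclidsLemma; prime⇒nonZero)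
  open import Data.Integer as ℤ using (ℤ; +_; _+_; _*_; _-_; ∣_∣)
  import Data.Integer.Properties as ℤ
  open import Data.Integer.Tactic.RingSolver using (solve-∀)
  open import Data.Sum using (inj₁; inj₂)
  open import Data.Product using (∃; _×_; _,_)
  open import Data.Product.Function.NonDependent.Propositional using (_×-⇔_)
  open import Function.Bundles using (_⇔_; mk⇔; Equivalence)
  open import Function.Properties.Equivalence using () renaming (trans to ⇔-trans; refl to ⇔-refl)
  open import Relation.Binary.PropositionalEquality

  Admissibleℕ : (p a n : ℕ) → Set
  Admissibleℕ p a n = ∃ λ q → n ≡ p ℕ.* p ℕ.* q × p ∣ a ℕ.* q

  NatConditions : (p a₁₂ a₂₃ a₂₄ : ℕ) → Set
  NatConditions p a₁₂ a₂₃ a₂₄ =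
    Admissibleℕ p a₁₂ (a₂₃ ℕ.* (a₂₃ ∸ 1)) × Admissibleℕ p a₁₂ (a₂₃ ℕ.* a₂₄) ×
    ∃ λ m → a₂₄ ≡ p ℕ.* m × p ∣ a₁₂ ℕ.* (m ℕ.* (m ∸ 1))

  Admissible-cong : ∀ {P a e e′} → e ≡ e′ → Admissible P a e ⇔ Admissible P a e′
  Admissible-cong refl = ⇔-refl

  Admissible⇔Admissibleℕ : ∀ p a n → Admissible (+ p) (+ a) (+ n) ⇔ Admissibleℕ p a n
  Admissible⇔Admissibleℕ p a n = mk⇔ to from
    where
    to : Admissible (+ p) (+ a) (+ n) → Admissibleℕ p a n
    to adm = ∣ q ∣ , n≡p²∣q∣ , divides ∣ r ∣ a∣q∣≡∣r∣p
      where
      open Admissible adm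
      n≡p²∣q∣ : n ≡ p ℕ.* p ℕ.* ∣ q ∣
      n≡p²∣q∣ = trans (cong ∣_∣ e≡P²q) (trans (ℤ.abs-* (+ p ℤ.* + p) q) (cong (ℕ._* ∣ q ∣) (ℤ.abs-* (+ p) (+ p))))
      a∣q∣≡∣r∣p : a ℕ.* ∣ q ∣ ≡ ∣ r ∣ ℕ.* p
      a∣q∣≡∣r∣p = trans (sym (ℤ.abs-* (+ a) q)) (trans (cong ∣_∣ a₁₂q≡Pr) (trans (ℤ.abs-* (+ p) r) (ℕ.*-comm p ∣ r ∣)))
    from : Admissibleℕ p a n → Admissible (+ p) (+ a) (+ n)
    from (q , n≡p²q , divides r aq≡rp) = record
      { q = + q ; r = + r
      ; e≡P²q = trans (cong +_ n≡p²q) (trans (ℤ.pos-* (p ℕ.* p) q) (cong (_* + q) (ℤ.pos-* p p)))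
      ; a₁₂q≡Pr = trans (sym (ℤ.pos-* a q)) (trans (cong +_ (trans aq≡rp (ℕ.*-comm r p))) (ℤ.pos-* p r)) }

  Admissibleℕ-p²⇔ : ∀ p a e .{{_ : NonZero p}} → Admissibleℕ p a (p ℕ.* p ℕ.* e) ⇔ p ∣ a ℕ.* e
  Admissibleℕ-p²⇔ p a e = mk⇔
    (λ { (q , p²e≡p²q , p∣aq) →
           subst (λ x → p ∣ a ℕ.* x) (sym (ℕ.*-cancelˡ-≡ e q (p ℕ.* p) {{ℕ.m*n≢0 p p}} p²e≡p²q)) p∣aq })
    (λ p∣ae → e , refl , p∣ae)

  +a*+a-+a≡+[a*[a∸1]] : ∀ a → + a * + a - + a ≡ + (a ℕ.* (a ∸ 1))
  +a*+a-+a≡+[a*[a∸1]] zero    = refl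
  +a*+a-+a≡+[a*[a∸1]] (suc n) = trans (1+x-identity (+ n)) (sym (ℤ.pos-* (suc n) n))
    where
    1+x-identity : ∀ x → (+ 1 + x) * (+ 1 + x) - (+ 1 + x) ≡ (+ 1 + x) * x
    1+x-identity = solve-∀

  +[pm]²-+p*+[pm]≡+[p²*m*[m∸1]] : ∀ p m → + (p ℕ.* m) * + (p ℕ.* m) - + p * + (p ℕ.* m) ≡ + (p ℕ.* p ℕ.* (m ℕ.* (m ∸ 1)))
  +[pm]²-+p*+[pm]≡+[p²*m*[m∸1]] p m = begin
    + (p ℕ.* m) * + (p ℕ.* m) - + p * + (p ℕ.* m)  ≡⟨ cong (λ x → x * x - + p * x) (ℤ.pos-* p m) ⟩
    + p * + m * (+ p * + m) - + p * (+ p * + m)    ≡⟨ factor (+ p) (+ m) ⟩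
    + p * + p * (+ m * + m - + m)                  ≡⟨ cong (+ p * + p *_) (+a*+a-+a≡+[a*[a∸1]] m) ⟩
    + p * + p * + (m ℕ.* (m ∸ 1))                  ≡⟨ cong (_* + (m ℕ.* (m ∸ 1))) (ℤ.pos-* p p) ⟨
    + (p ℕ.* p) * + (m ℕ.* (m ∸ 1))                ≡⟨ ℤ.pos-* (p ℕ.* p) (m ℕ.* (m ∸ 1)) ⟨
    + (p ℕ.* p ℕ.* (m ℕ.* (m ∸ 1)))                ∎
    where
    open ≡-Reasoning
    factor : ∀ P M → P * M * (P * M) - P * (P * M) ≡ P * P * (M * M - M)
    factor = solve-∀

  square-from-difference : ∀ x P q → x * x - P * x ≡ P * P * q → x * x ≡ P * (x + P * q)
  square-from-difference x P q h = trans (split x P) (trans (cong (_+ P * x) h) (regroup x P q))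
    where
    split : ∀ x P → x * x ≡ x * x - P * x + P * x
    split = solve-∀
    regroup : ∀ x P q → P * P * q + P * x ≡ P * (x + P * q)
    regroup = solve-∀

  module _ {p : ℕ} (p-prime : Prime p) where

    private instance
      p≢0 : NonZero p
      p≢0 = prime⇒nonZero p-prime

    Admissible-a₂₄⇔ : ∀ a a₂₄ → Admissible (+ p) (+ a) (+ a₂₄ * + a₂₄ - + p * + a₂₄)
                      ⇔ ∃ λ m → a₂₄ ≡ p ℕ.* m × p ∣ a ℕ.* (m ℕ.* (m ∸ 1))
    Admissible-a₂₄⇔ a a₂₄ = mk⇔ to from
      where
      reduce : ∀ m → Admissible (+ p) (+ a) (+ (p ℕ.* m) * + (p ℕ.* m) - + p * + (p ℕ.* m)) ⇔ p ∣ a ℕ.* (m ℕ.* (m ∸ 1))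
      reduce m = ⇔-trans (Admissible-cong (+[pm]²-+p*+[pm]≡+[p²*m*[m∸1]] p m))
                         (⇔-trans (Admissible⇔Admissibleℕ p a _) (Admissibleℕ-p²⇔ p a _))
      p∣a₂₄ : Admissible (+ p) (+ a) (+ a₂₄ * + a₂₄ - + p * + a₂₄) → p ∣ a₂₄
      p∣a₂₄ adm with euclidsLemma a₂₄ a₂₄ p-prime (divides ∣ + a₂₄ + + p * q ∣ a₂₄²≡)
        where
        open Admissible adm
        a₂₄²≡ : a₂₄ ℕ.* a₂₄ ≡ ∣ + a₂₄ + + p * q ∣ ℕ.* p
        a₂₄²≡ = trans (cong ∣_∣ (trans (ℤ.pos-* a₂₄ a₂₄) (square-from-difference (+ a₂₄) (+ p) q e≡P²q)))
                       (trans (ℤ.abs-* (+ p) (+ a₂₄ + + p * q)) (ℕ.*-comm p _))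
      ... | inj₁ p∣a₂₄ = p∣a₂₄
      ... | inj₂ p∣a₂₄ = p∣a₂₄
      to : Admissible (+ p) (+ a) (+ a₂₄ * + a₂₄ - + p * + a₂₄) → ∃ λ m → a₂₄ ≡ p ℕ.* m × p ∣ a ℕ.* (m ℕ.* (m ∸ 1))
      to adm with p∣a₂₄ adm
      ... | divides m refl = m , ℕ.*-comm m p ,
        Equivalence.to (reduce m) (subst (λ x → Admissible (+ p) (+ a) (+ x * + x - + p * + x)) (ℕ.*-comm m p) adm)
      from : (∃ λ m → a₂₄ ≡ p ℕ.* m × p ∣ a ℕ.* (m ℕ.* (m ∸ 1))) → Admissible (+ p) (+ a) (+ a₂₄ * + a₂₄ - + p * + a₂₄)
      from (m , refl , p∣) = Equivalence.from (reduce m) p∣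

    ClosureConditions⇔NatConditions : ∀ a₁₂ a₂₃ a₂₄ →
      ClosureConditions (+ p) (+ a₁₂) (+ a₂₃) (+ a₂₄) ⇔ NatConditions p a₁₂ a₂₃ a₂₄
    ClosureConditions⇔NatConditions a₁₂ a₂₃ a₂₄ =
      ⇔-trans (Admissible-cong (+a*+a-+a≡+[a*[a∸1]] a₂₃)) (Admissible⇔Admissibleℕ p a₁₂ _) ×-⇔
      ⇔-trans (Admissible-cong (sym (ℤ.pos-* a₂₃ a₂₄))) (Admissible⇔Admissibleℕ p a₁₂ _) ×-⇔
      Admissible-a₂₄⇔ a₁₂ a₂₄

module AdmissibleTriples where

  open NaturalConditions using (Admissibleℕ; NatConditions)
  open import Data.Nat using (zero; suc; pred; z<s; _+_; _*_; _∸_; _^_; _<_; NonZero; nonTrivial⇒n>1)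
  open import Data.Nat.Properties
  open import Data.Nat.Divisibility using (_∣_; divides; _∣0; ∣⇒≤; >⇒∤)
  open import Data.Nat.Primality using (prime⇒nonZero; prime⇒nonTrivial)
  open import Data.Nat.Tactic.RingSolver using (solve-∀)
  open import Data.List using (List; []; _∷_; map; _++_; cartesianProductWith; upTo; length)
  open import Data.List.Properties using (length-++; length-map; length-upTo)
  open import Data.List.Membership.Propositional using (_∈_)
  open import Data.List.Membership.Propositional.Properties
  open import Data.List.Relation.Unary.All as All using (All)
  import Data.List.Relation.Unary.All.Properties as All
  open import Data.List.Relation.Unary.Unique.Propositional using (Unique)
  import Data.List.Relation.Unary.Unique.Propositional.Properties as Unique
  open import Data.List.Relation.Binary.Disjoint.Propositional using (Disjoint)
  open import Data.Empty using (⊥-elim)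
  open import Data.Sum using (_⊎_; inj₁; inj₂)
  open import Data.Product using (_×_; _,_)
  open import Function.Bundles using (_⇔_; mk⇔)
  open import Relation.Nullary using (¬_)
  open import Relation.Binary.PropositionalEquality

  Triple : Set
  Triple = ℕ × ℕ × ℕ

  length-cartesianProductWith : ∀ {A B C : Set} (f : A → B → C) xs ys →
    length (cartesianProductWith f xs ys) ≡ length xs * length ys
  length-cartesianProductWith f []       ys = refl
  length-cartesianProductWith f (x ∷ xs) ys =
    trans (length-++ (map (f x) ys)) (cong₂ _+_ (length-map (f x) ys) (length-cartesianProductWith f xs ys))

  module _ (p : ℕ) where

    triple₁ triple₂ triple₃ triple₄ : ℕ → ℕ → Triple
    triple₁ k m = 0 , p * p * k , p * m
    triple₂ k m = 0 , suc (p * p * k) , p * (p * m)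
    triple₃ a j = suc a , 0 , p * (p * j)
    triple₄ a j = suc a , 0 , p * suc (p * j)

    triple₅ : ℕ → Triple
    triple₅ a = suc a , 1 , 0

    family₁ family₂ family₃ family₄ family₅ admissibleTriples : List Triple
    family₁ = cartesianProductWith triple₁ (upTo p) (upTo (p * p))
    family₂ = cartesianProductWith triple₂ (upTo p) (upTo p)
    family₃ = cartesianProductWith triple₃ (upTo (pred p)) (upTo p)
    family₄ = cartesianProductWith triple₄ (upTo (pred p)) (upTo p)
    family₅ = map triple₅ (upTo (pred p))
    admissibleTriples = family₁ ++ family₂ ++ family₃ ++ family₄ ++ family₅

    length-admissibleTriples :
      length admissibleTriples ≡ p * (p * p) + (p * p + ((pred p) * p + ((pred p) * p + (pred p))))
    length-admissibleTriples =
      trans (length-++ family₁) (cong₂ _+_ (length-family triple₁ p (p * p))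
      (trans (length-++ family₂) (cong₂ _+_ (length-family triple₂ p p)
      (trans (length-++ family₃) (cong₂ _+_ (length-family triple₃ (pred p) p)
      (trans (length-++ family₄) (cong₂ _+_ (length-family triple₄ (pred p) p)
      (trans (length-map triple₅ (upTo (pred p))) (length-upTo (pred p))))))))))
      where
      length-family : ∀ (f : ℕ → ℕ → Triple) m n → length (cartesianProductWith f (upTo m) (upTo n)) ≡ m * n
      length-family f m n = trans (length-cartesianProductWith f (upTo m) (upTo n)) (cong₂ _*_ (length-upTo m) (length-upTo n))

  k<n∧r<m⇒m*k+r<m*n : ∀ m k r n → k < n → r < m → m * k + r < m * n
  k<n∧r<m⇒m*k+r<m*n m k r n k<n r<m = ≤-trans (+-monoʳ-< (m * k) r<m)
    (≤-trans (≤-reflexive (trans (+-comm (m * k) m) (sym (*-suc m k)))) (*-monoʳ-≤ m k<n))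

  m*n<n⇒m≡0 : ∀ m n → m * n < n → m ≡ 0
  m*n<n⇒m≡0 zero    n _  = refl
  m*n<n⇒m≡0 (suc m) n lt = ⊥-elim (<⇒≱ lt (m≤m+n n (m * n)))

  ∣∧<⇒≡0 : ∀ {d n} → d ∣ n → n < d → n ≡ 0
  ∣∧<⇒≡0 {n = zero}  _   _  = refl
  ∣∧<⇒≡0 {n = suc n} d∣n lt = ⊥-elim (>⇒∤ lt d∣n)

  module _ {p : ℕ} (p-prime : Prime p) where

    open PrimePowers p-prime

    private instance
      p≢0 : NonZero p
      p≢0 = prime⇒nonZero p-prime

    1<p : 1 < p
    1<p = nonTrivial⇒n>1 p {{prime⇒nonTrivial p-prime}}

    Valid : Triple → Set
    Valid (a₁₂ , a₂₃ , a₂₄) = (a₁₂ < p × a₂₃ < p * (p * p) × a₂₄ < p * (p * p)) × NatConditions p a₁₂ a₂₃ a₂₄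

    private
      p²k<p³ : ∀ {k} → k < p → p * p * k < p * (p * p)
      p²k<p³ {k} k<p = subst (_< p * (p * p)) (sym (*-assoc p p k)) (*-monoʳ-< p (*-monoʳ-< p k<p))

      pm<p³ : ∀ {m} → m < p * p → p * m < p * (p * p)
      pm<p³ = *-monoʳ-< p

      1+p²k<p³ : ∀ {k} → k < p → suc (p * p * k) < p * (p * p)
      1+p²k<p³ {k} k<p = subst₂ _<_ (+-comm (p * p * k) 1) (*-assoc p p p)
        (k<n∧r<m⇒m*k+r<m*n (p * p) k 1 p k<p (<-≤-trans 1<p (m≤m*n p p)))

      p[1+pj]<p³ : ∀ {j} → j < p → p * suc (p * j) < p * (p * p)
      p[1+pj]<p³ {j} j<p = *-monoʳ-< p (subst (_< p * p) (+-comm (p * j) 1) (k<n∧r<m⇒m*k+r<m*n p j 1 p j<p 1<p))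

      0<p : 0 < p
      0<p = <-trans z<s 1<p

      0<p³ : 0 < p * (p * p)
      0<p³ = subst (_< p * (p * p)) (*-zeroʳ (p * p)) (p²k<p³ 0<p)

      1<p³ : 1 < p * (p * p)
      1<p³ = subst (_< p * (p * p)) (cong suc (*-zeroʳ (p * p))) (1+p²k<p³ 0<p)

      Admissibleℕ-0 : ∀ a → Admissibleℕ p a 0
      Admissibleℕ-0 a = 0 , sym (*-zeroʳ (p * p)) , divides 0 (*-zeroʳ a)

      p∣suc-a*0 : ∀ a → p ∣ suc a * 0
      p∣suc-a*0 a = divides 0 (*-zeroʳ (suc a))

      x*[p*p*k]≡p*p*[x*k] : ∀ x p k → x * (p * p * k) ≡ p * p * (x * k)
      x*[p*p*k]≡p*p*[x*k] = solve-∀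
      x*[p*[p*m]]≡p*p*[x*m] : ∀ x p m → x * (p * (p * m)) ≡ p * p * (x * m)
      x*[p*[p*m]]≡p*p*[x*m] = solve-∀
      a*[p*j*x]≡a*[j*x]*p : ∀ a p j x → a * (p * j * x) ≡ a * (j * x) * p
      a*[p*j*x]≡a*[j*x]*p = solve-∀
      a*[x*[p*j]]≡a*[x*j]*p : ∀ a x p j → a * (x * (p * j)) ≡ a * (x * j) * p
      a*[x*[p*j]]≡a*[x*j]*p = solve-∀

    valid₁ : ∀ {k m} → k < p → m < p * p → Valid (triple₁ p k m)
    valid₁ {k} {m} k<p m<p² =
      (0<p , p²k<p³ k<p , pm<p³ m<p²) ,
      (k * (p * p * k ∸ 1) , *-assoc (p * p) k (p * p * k ∸ 1) , p ∣0) , (k * (p * m) , *-assoc (p * p) k (p * m) , p ∣0) , (m , refl , p ∣0)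

    valid₂ : ∀ {k m} → k < p → m < p → Valid (triple₂ p k m)
    valid₂ {k} {m} k<p m<p =
      (0<p , 1+p²k<p³ k<p , pm<p³ (*-monoʳ-< p m<p)) ,
      (suc (p * p * k) * k , x*[p*p*k]≡p*p*[x*k] (suc (p * p * k)) p k , p ∣0) ,
      (suc (p * p * k) * m , x*[p*[p*m]]≡p*p*[x*m] (suc (p * p * k)) p m , p ∣0) , (p * m , refl , p ∣0)

    valid₃ : ∀ {a j} → a < pred p → j < p → Valid (triple₃ p a j)
    valid₃ {a} {j} a<p-1 j<p =
      (m≤pred[n]⇒suc[m]≤n a<p-1 , 0<p³ , pm<p³ (*-monoʳ-< p j<p)) ,
      Admissibleℕ-0 (suc a) , Admissibleℕ-0 (suc a) ,
      (p * j , refl , divides (suc a * (j * (p * j ∸ 1))) (a*[p*j*x]≡a*[j*x]*p (suc a) p j (p * j ∸ 1)))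

    valid₄ : ∀ {a j} → a < pred p → j < p → Valid (triple₄ p a j)
    valid₄ {a} {j} a<p-1 j<p =
      (m≤pred[n]⇒suc[m]≤n a<p-1 , 0<p³ , p[1+pj]<p³ j<p) ,
      Admissibleℕ-0 (suc a) , Admissibleℕ-0 (suc a) ,
      (suc (p * j) , refl , divides (suc a * (suc (p * j) * j)) (a*[x*[p*j]]≡a*[x*j]*p (suc a) (suc (p * j)) p j))

    valid₅ : ∀ {a} → a < pred p → Valid (triple₅ p a)
    valid₅ {a} a<p-1 =
      (m≤pred[n]⇒suc[m]≤n a<p-1 , 1<p³ , 0<p³) , Admissibleℕ-0 (suc a) , Admissibleℕ-0 (suc a) , (0 , sym (*-zeroʳ p) , p∣suc-a*0 a)

    allValid : All Valid (admissibleTriples p)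
    allValid =
      All.++⁺ (pairs (triple₁ p) valid₁) (All.++⁺ (pairs (triple₂ p) valid₂) (All.++⁺ (pairs (triple₃ p) valid₃)
      (All.++⁺ (pairs (triple₄ p) valid₄) (All.map⁺ (All.applyUpTo⁺₁ (λ a → a) (pred p) valid₅)))))
      where
      pairs : ∀ {m n} (f : ℕ → ℕ → Triple) → (∀ {x y} → x < m → y < n → Valid (f x y)) →
              All Valid (cartesianProductWith f (upTo m) (upTo n))
      pairs f valid = All.cartesianProductWith⁺ (setoid ℕ) (setoid ℕ) f _ _ (λ x∈ y∈ → valid (∈-upTo⁻ x∈) (∈-upTo⁻ y∈))

    private
      p²k<p³⇒k<p : ∀ {k} → p * p * k < p * (p * p) → k < p
      p²k<p³⇒k<p {k} b = *-cancelˡ-< (p * p) k p (subst (p * p * k <_) (sym (*-assoc p p p)) b)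

      p[pm]<p³⇒m<p : ∀ {m} → p * (p * m) < p * (p * p) → m < p
      p[pm]<p³⇒m<p {m} b = *-cancelˡ-< p m p (*-cancelˡ-< p (p * m) (p * p) b)

      ∈family₁ : ∀ {a₂₃ a₂₄} k m → a₂₃ ≡ p * p * k → a₂₄ ≡ p * m →
                 a₂₃ < p * (p * p) → a₂₄ < p * (p * p) → (0 , a₂₃ , a₂₄) ∈ admissibleTriples p
      ∈family₁ k m refl refl b₂₃ b₂₄ = ∈-++⁺ˡ (∈-cartesianProductWith⁺ (triple₁ p)
        (∈-upTo⁺ (p²k<p³⇒k<p b₂₃)) (∈-upTo⁺ (*-cancelˡ-< p m (p * p) b₂₄)))

      ∈family₂ : ∀ {a₂₃ a₂₄} k m → a₂₃ ≡ suc (p * p * k) → a₂₄ ≡ p * (p * m) →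
                 a₂₃ < p * (p * p) → a₂₄ < p * (p * p) → (0 , a₂₃ , a₂₄) ∈ admissibleTriples p
      ∈family₂ k m refl refl b₂₃ b₂₄ = ∈-++⁺ʳ (family₁ p) (∈-++⁺ˡ (∈-cartesianProductWith⁺ (triple₂ p)
        (∈-upTo⁺ (p²k<p³⇒k<p (<-trans (n<1+n _) b₂₃))) (∈-upTo⁺ (p[pm]<p³⇒m<p b₂₄))))

      ∈family₃ : ∀ {a a₂₄} j → a₂₄ ≡ p * (p * j) →
                 suc a < p → a₂₄ < p * (p * p) → (suc a , 0 , a₂₄) ∈ admissibleTriples p
      ∈family₃ j refl b₁₂ b₂₄ = ∈-++⁺ʳ (family₁ p) (∈-++⁺ʳ (family₂ p) (∈-++⁺ˡ (∈-cartesianProductWith⁺ (triple₃ p)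
        (∈-upTo⁺ (suc[m]≤n⇒m≤pred[n] b₁₂)) (∈-upTo⁺ (p[pm]<p³⇒m<p b₂₄)))))

      ∈family₄ : ∀ {a a₂₄} j → a₂₄ ≡ p * suc (p * j) →
                 suc a < p → a₂₄ < p * (p * p) → (suc a , 0 , a₂₄) ∈ admissibleTriples p
      ∈family₄ j refl b₁₂ b₂₄ = ∈-++⁺ʳ (family₁ p) (∈-++⁺ʳ (family₂ p) (∈-++⁺ʳ (family₃ p) (∈-++⁺ˡ
        (∈-cartesianProductWith⁺ (triple₄ p) (∈-upTo⁺ (suc[m]≤n⇒m≤pred[n] b₁₂))
          (∈-upTo⁺ (*-cancelˡ-< p j p (<-trans (n<1+n _) (*-cancelˡ-< p (suc (p * j)) (p * p) b₂₄))))))))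

      ∈family₅ : ∀ {a} → suc a < p → (suc a , 1 , 0) ∈ admissibleTriples p
      ∈family₅ b₁₂ = ∈-++⁺ʳ (family₁ p) (∈-++⁺ʳ (family₂ p) (∈-++⁺ʳ (family₃ p) (∈-++⁺ʳ (family₄ p)
        (∈-map⁺ (triple₅ p) (∈-upTo⁺ (suc[m]≤n⇒m≤pred[n] b₁₂))))))

      p³≡p^3 : p * (p * p) ≡ p ^ 3
      p³≡p^3 = cong (λ x → p * (p * x)) (sym (*-identityʳ p))

      p²∣∧p∣quotient⇒p^3∣ : ∀ {n q} → n ≡ p * p * q → p ∣ q → p ^ 3 ∣ n
      p²∣∧p∣quotient⇒p^3∣ {n} {q} n≡p²q (divides q′ refl) = divides q′ (trans n≡p²q (identity p q′))
        where
        identity : ∀ p q′ → p * p * (q′ * p) ≡ q′ * (p * (p * (p * 1)))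
        identity = solve-∀

      idempotent-below-p³ : ∀ {a} → a < p * (p * p) → p ^ 3 ∣ a * (a ∸ 1) → a ≡ 0 ⊎ a ≡ 1
      idempotent-below-p³ {a} a<p³ p³∣ with idempotent-mod-^ 3 a p³∣
      ... | inj₁ (j , refl) = inj₁ (cong (_* p ^ 3) (m*n<n⇒m≡0 j (p ^ 3) (subst (j * p ^ 3 <_) p³≡p^3 a<p³)))
      ... | inj₂ (j , refl) = inj₂ (cong (λ j → suc (j * p ^ 3)) (m*n<n⇒m≡0 j (p ^ 3) (subst (j * p ^ 3 <_) p³≡p^3 (<-trans (n<1+n _) a<p³))))

      p∣X*m : ∀ X m q → X * (p * m) ≡ p * p * q → p ∣ X * m
      p∣X*m X m q e = divides q (*-cancelˡ-≡ (X * m) (q * p) p (trans (left X p m) (trans e (right p q))))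
        where
        left : ∀ X p m → p * (X * m) ≡ X * (p * m)
        left = solve-∀
        right : ∀ p q → p * p * q ≡ p * (q * p)
        right = solve-∀

      k*p^2≡p*p*k : ∀ k → k * p ^ 2 ≡ p * p * k
      k*p^2≡p*p*k k = trans (cong (λ x → k * (p * x)) (*-identityʳ p)) (*-comm k (p * p))

      p∣k*p^2 : ∀ k → p ∣ k * p ^ 2
      p∣k*p^2 k = divides (p * k) (trans (k*p^2≡p*p*k k) (trans (*-assoc p p k) (*-comm p (p * k))))

      p∤1+a : ∀ {a} → suc a < p → ¬ p ∣ suc a
      p∤1+a 1+a<p p∣1+a = <⇒≱ 1+a<p (∣⇒≤ p∣1+a)

      p^3∣∧<p³⇒≡0 : ∀ {n} → p ^ 3 ∣ n → n < p * (p * p) → n ≡ 0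
      p^3∣∧<p³⇒≡0 {n} p³∣n n<p³ = ∣∧<⇒≡0 p³∣n (subst (n <_) p³≡p^3 n<p³)

    classify : ∀ {t} → Valid t → t ∈ admissibleTriples p
    classify {zero , a₂₃ , a₂₄} ((_ , b₂₃ , b₂₄) , (q₁ , e₁ , _) , (q₂ , e₂ , _) , (m , a₂₄≡pm , _))
      with idempotent-mod-^ 2 a₂₃ (divides q₁ (trans e₁ (sym (k*p^2≡p*p*k q₁))))
    ... | inj₁ (k , a₂₃≡kp²) = ∈family₁ k m (trans a₂₃≡kp² (k*p^2≡p*p*k k)) a₂₄≡pm b₂₃ b₂₄
    ... | inj₂ (k , a₂₃≡1+kp²)
      with ∤m∧∣m*n⇒∣n (∣n⇒∤1+n (p∣k*p^2 k))
             (p∣X*m (suc (k * p ^ 2)) m q₂ (subst₂ (λ x y → x * y ≡ p * p * q₂) a₂₃≡1+kp² a₂₄≡pm e₂))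
    ... | divides m′ refl = ∈family₂ k m′ (trans a₂₃≡1+kp² (cong suc (k*p^2≡p*p*k k)))
            (trans a₂₄≡pm (cong (p *_) (*-comm m′ p))) b₂₃ b₂₄
    classify {suc a , a₂₃ , a₂₄}
             ((b₁₂ , b₂₃ , b₂₄) , (q₁ , e₁ , p∣aq₁) , (q₂ , e₂ , p∣aq₂) , (m , a₂₄≡pm , p∣am[m-1]))
      with idempotent-below-p³ b₂₃ (p²∣∧p∣quotient⇒p^3∣ e₁ (∤m∧∣m*n⇒∣n (p∤1+a b₁₂) p∣aq₁))
    ... | inj₂ refl = subst (λ x → (suc a , 1 , x) ∈ admissibleTriples p)
            (sym (p^3∣∧<p³⇒≡0
              (p²∣∧p∣quotient⇒p^3∣ (trans (sym (*-identityˡ a₂₄)) e₂) (∤m∧∣m*n⇒∣n (p∤1+a b₁₂) p∣aq₂)) b₂₄))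
            (∈family₅ b₁₂)
    ... | inj₁ refl with idempotent-mod-p m (∤m∧∣m*n⇒∣n (p∤1+a b₁₂) p∣am[m-1])
    ...   | inj₁ (j , m≡pj)   = ∈family₃ j (trans a₂₄≡pm (cong (p *_) m≡pj)) b₁₂ b₂₄
    ...   | inj₂ (j , m≡1+pj) = ∈family₄ j (trans a₂₄≡pm (cong (p *_) m≡1+pj)) b₁₂ b₂₄

    private
      disjoint-++ : ∀ {xs ys zs : List Triple} → Disjoint xs ys → Disjoint xs zs → Disjoint xs (ys ++ zs)
      disjoint-++ {ys = ys} xs#ys xs#zs (v∈xs , v∈ys++zs) with ∈-++⁻ ys v∈ys++zs
      ... | inj₁ v∈ys = xs#ys (v∈xs , v∈ys)
      ... | inj₂ v∈zs = xs#zs (v∈xs , v∈zs)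

      images-disjoint : ∀ (f : ℕ → ℕ → Triple) xs ys (g : ℕ → ℕ → Triple) us vs → (∀ {a b c d} → f a b ≢ g c d) →
                        Disjoint (cartesianProductWith f xs ys) (cartesianProductWith g us vs)
      images-disjoint f xs ys g us vs f≢g (v∈₁ , v∈₂)
        with ∈-cartesianProductWith⁻ f xs ys v∈₁ | ∈-cartesianProductWith⁻ g us vs v∈₂
      ... | _ , _ , _ , _ , refl | _ , _ , _ , _ , fab≡gcd = f≢g fab≡gcd

      image-family₅-disjoint : ∀ (f : ℕ → ℕ → Triple) xs ys → (∀ {a b c} → f a b ≢ triple₅ p c) →
                               Disjoint (cartesianProductWith f xs ys) (family₅ p)
      image-family₅-disjoint f xs ys f≢g (v∈₁ , v∈₂)
        with ∈-cartesianProductWith⁻ f xs ys v∈₁ | ∈-map⁻ (triple₅ p) v∈₂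
      ... | _ , _ , _ , _ , refl | _ , _ , fab≡gc = f≢g fab≡gc

      second : ∀ {a b c a′ b′ c′ : ℕ} → (a , b , c) ≡ (a′ , b′ , c′) → b ≡ b′
      second refl = refl

      third : ∀ {a b c a′ b′ c′ : ℕ} → (a , b , c) ≡ (a′ , b′ , c′) → c ≡ c′
      third refl = refl

      first : ∀ {a b c a′ b′ c′ : ℕ} → (a , b , c) ≡ (a′ , b′ , c′) → a ≡ a′
      first refl = refl

      p*-injective : ∀ {m n} → p * m ≡ p * n → m ≡ n
      p*-injective {m} {n} = *-cancelˡ-≡ m n p

      triple₁≢triple₂ : ∀ {k m k′ m′} → triple₁ p k m ≢ triple₂ p k′ m′
      triple₁≢triple₂ {k} {m} {k′} e = ∣n⇒∤1+n (divides (p * k′) (identity k′)) (subst (p ∣_) (second e) (divides (p * k) (identity k)))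
        where
        identity : ∀ k → p * p * k ≡ p * k * p
        identity k = trans (*-assoc p p k) (*-comm p (p * k))

      triple₃≢triple₄ : ∀ {a j a′ j′} → triple₃ p a j ≢ triple₄ p a′ j′
      triple₃≢triple₄ {j = j} {j′ = j′} e =
        ∣n⇒∤1+n (divides j′ (*-comm p j′)) (subst (p ∣_) (p*-injective (third e)) (divides j (*-comm p j)))

    ∈admissibleTriples⇔Valid : ∀ {t} → t ∈ admissibleTriples p ⇔ Valid t
    ∈admissibleTriples⇔Valid = mk⇔ (All.lookup allValid) classify

    unique-admissibleTriples : Unique (admissibleTriples p)
    unique-admissibleTriples =
      Unique.++⁺ unique₁ (Unique.++⁺ unique₂ (Unique.++⁺ unique₃ (Unique.++⁺ unique₄ unique₅
        disjoint₄) disjoint₃) disjoint₂) disjoint₁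
      where
      [p] [p²] [p-1] : List ℕ
      [p] = upTo p
      [p²] = upTo (p * p)
      [p-1] = upTo (pred p)
      grid : ∀ m n (f : ℕ → ℕ → Triple) → (∀ {w x y z} → f w y ≡ f x z → w ≡ x × y ≡ z) →
             Unique (cartesianProductWith f (upTo m) (upTo n))
      grid m n f f-injective = Unique.cartesianProductWith⁺ f f-injective (Unique.upTo⁺ m) (Unique.upTo⁺ n)
      p²*-injective : ∀ {m n} → p * p * m ≡ p * p * n → m ≡ n
      p²*-injective {m} {n} e = p*-injective (p*-injective (trans (sym (*-assoc p p m)) (trans e (*-assoc p p n))))
      unique₁ : Unique (family₁ p)
      unique₁ = grid p (p * p) (triple₁ p) (λ e → p²*-injective (second e) , p*-injective (third e))
      unique₂ : Unique (family₂ p)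
      unique₂ = grid p p (triple₂ p) (λ e → p²*-injective (suc-injective (second e)) , p*-injective (p*-injective (third e)))
      unique₃ : Unique (family₃ p)
      unique₃ = grid (pred p) p (triple₃ p) (λ e → suc-injective (first e) , p*-injective (p*-injective (third e)))
      unique₄ : Unique (family₄ p)
      unique₄ = grid (pred p) p (triple₄ p) (λ e → suc-injective (first e) , p*-injective (suc-injective (p*-injective (third e))))
      unique₅ : Unique (family₅ p)
      unique₅ = Unique.map⁺ (λ e → suc-injective (first e)) (Unique.upTo⁺ (pred p))
      disjoint₄ : Disjoint (family₄ p) (family₅ p)
      disjoint₄ = image-family₅-disjoint (triple₄ p) [p-1] [p] (λ ())
      disjoint₃ : Disjoint (family₃ p) (family₄ p ++ family₅ p)
      disjoint₃ = disjoint-++ (images-disjoint (triple₃ p) [p-1] [p] (triple₄ p) [p-1] [p] triple₃≢triple₄)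
        (image-family₅-disjoint (triple₃ p) [p-1] [p] (λ ()))
      disjoint₂ : Disjoint (family₂ p) (family₃ p ++ family₄ p ++ family₅ p)
      disjoint₂ = disjoint-++ (images-disjoint (triple₂ p) [p] [p] (triple₃ p) [p-1] [p] (λ ()))
        (disjoint-++ (images-disjoint (triple₂ p) [p] [p] (triple₄ p) [p-1] [p] (λ ())) (image-family₅-disjoint (triple₂ p) [p] [p] (λ ())))
      disjoint₁ : Disjoint (family₁ p) (family₂ p ++ family₃ p ++ family₄ p ++ family₅ p)
      disjoint₁ = disjoint-++ (images-disjoint (triple₁ p) [p] [p²] (triple₂ p) [p] [p] triple₁≢triple₂)
        (disjoint-++ (images-disjoint (triple₁ p) [p] [p²] (triple₃ p) [p-1] [p] (λ ()))
        (disjoint-++ (images-disjoint (triple₁ p) [p] [p²] (triple₄ p) [p-1] [p] (λ ())) (image-family₅-disjoint (triple₁ p) [p] [p²] (λ ()))))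

module IrreducibleMatrices where

  open CandidateMatrices using (candidate)
  open import Data.Nat as ℕ using (zero; suc; _∸_; _^_; _<_; z≤n; s≤s)
  import Data.Nat.Properties as ℕ
  open import Data.Integer as ℤ using (+_; _*_)
  import Data.Integer.Properties as ℤ
  open import Data.Integer.Tactic.RingSolver using (solve-∀)
  open import Data.Fin as Fin using (toℕ; inject₁)
  open import Data.Fin.Patterns using (0F; 1F; 2F; 3F; 4F)
  open import Data.Vec using (Vec; _∷_; []; lookup)
  open import Data.Product using (∃; _×_; _,_)
  open import Relation.Nullary.Decidable using (True; toWitness)
  open import Relation.Binary.PropositionalEquality

  open IsIrredSubringMatrix

  lookup-ext : ∀ {A : Set} {n} {xs ys : Vec A n} → (∀ i → lookup xs i ≡ lookup ys i) → xs ≡ ys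
  lookup-ext {xs = []}     {[]}     _  = refl
  lookup-ext {xs = x ∷ xs} {y ∷ ys} eq = cong₂ _∷_ (eq 0F) (lookup-ext (λ i → eq (Fin.suc i)))

  entry-ext : ∀ {m} {A B : Matrix m} → (∀ i j → entry A i j ≡ entry B i j) → A ≡ B
  entry-ext eq = lookup-ext (λ i → lookup-ext (eq i))

  pos-^ : ∀ m k → + (m ^ k) ≡ (+ m) ℤ.^ k
  pos-^ m zero    = refl
  pos-^ m (suc k) = trans (ℤ.pos-* m (m ^ k)) (cong (+ m *_) (pos-^ m k))

  Quintuple : Set
  Quintuple = ℕ × ℕ × ℕ × ℕ × ℕ

  α : Vec ℕ 4
  α = 2 ∷ 4 ∷ 1 ∷ 2 ∷ []

  module _ (p : ℕ) where

    matrixOf : Quintuple → Matrix 5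
    matrixOf (a₁₂ , a₁₃ , a₁₄ , a₂₃ , a₂₄) = candidate (+ p) (+ a₁₂) (+ a₁₃) (+ a₁₄) (+ a₂₃) (+ a₂₄)

    InRange : Quintuple → Set
    InRange (a₁₂ , a₁₃ , a₁₄ , a₂₃ , a₂₄) =
      a₁₂ < p × a₁₃ < p × a₁₄ < p × a₂₃ < p ℕ.* (p ℕ.* p) × a₂₄ < p ℕ.* (p ℕ.* p)

    private
      +[p^1]≡+p : + (p ^ 1) ≡ + p
      +[p^1]≡+p = cong +_ (ℕ.*-identityʳ p)

      +[p^2]≡+p*+p : + (p ^ 2) ≡ + p * + p
      +[p^2]≡+p*+p = trans (pos-^ p 2) (P^2 (+ p))
        where
        P^2 : ∀ P → P * (P * + 1) ≡ P * P
        P^2 = solve-∀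

      +[p^4]≡+p*+p*[+p*+p] : + (p ^ 4) ≡ + p * + p * (+ p * + p)
      +[p^4]≡+p*+p*[+p*+p] = trans (pos-^ p 4) (P^4 (+ p))
        where
        P^4 : ∀ P → P * (P * (P * (P * + 1))) ≡ P * P * (P * P)
        P^4 = solve-∀

      p^3≡ : p ^ 3 ≡ p ℕ.* (p ℕ.* p)
      p^3≡ = cong (λ x → p ℕ.* (p ℕ.* x)) (ℕ.*-identityʳ p)

    shape⇒irreducible : ∀ {q} → InRange q → ColSpanMulClosed (matrixOf q) → IsIrredSubringMatrix p 4 α (matrixOf q)
    shape⇒irreducible {a₁₂ , a₁₃ , a₁₄ , a₂₃ , a₂₄} (b₁₂ , b₁₃ , b₁₄ , b₂₃ , b₂₄) closed = record
      { upperTriangular = below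
      ; diagonal        = λ { 0F → sym +[p^2]≡+p*+p ; 1F → sym +[p^4]≡+p*+p*[+p*+p] ; 2F → sym +[p^1]≡+p ; 3F → sym +[p^2]≡+p*+p }
      ; lastColumn      = λ { 0F → refl ; 1F → refl ; 2F → refl ; 3F → refl ; 4F → refl }
      ; offDiagonal     = above
      ; subring         = closed
      }
      where
      M : Matrix 5
      M = matrixOf (a₁₂ , a₁₃ , a₁₄ , a₂₃ , a₂₄)
      <p^1 : ∀ {a} → a < p → a < p ^ 1
      <p^1 {a} = subst (a <_) (sym (ℕ.*-identityʳ p))
      <p^3 : ∀ {a} → a < p ℕ.* (p ℕ.* p) → a < p ^ 3
      <p^3 {a} = subst (a <_) (sym p^3≡)
      below : ∀ i j → toℕ j < toℕ i → entry M i j ≡ + 0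
      below 0F j ()
      below 1F 0F _ = refl
      below 1F (Fin.suc j) (s≤s ())
      below 2F 0F _ = refl
      below 2F 1F _ = refl
      below 2F (Fin.suc (Fin.suc j)) (s≤s (s≤s ()))
      below 3F 0F _ = refl
      below 3F 1F _ = refl
      below 3F 2F _ = refl
      below 3F (Fin.suc (Fin.suc (Fin.suc j))) (s≤s (s≤s (s≤s ())))
      below 4F 0F _ = refl
      below 4F 1F _ = refl
      below 4F 2F _ = refl
      below 4F 3F _ = refl
      below 4F 4F (s≤s (s≤s (s≤s (s≤s ()))))
      above : ∀ k l → toℕ k < toℕ l →
              ∃ λ a → a < p ^ (lookup α k ∸ 1) × entry M (inject₁ k) (inject₁ l) ≡ + (p ℕ.* a)
      above 0F 1F _ = a₁₂ , <p^1 b₁₂ , sym (ℤ.pos-* p a₁₂)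
      above 0F 2F _ = a₁₃ , <p^1 b₁₃ , sym (ℤ.pos-* p a₁₃)
      above 0F 3F _ = a₁₄ , <p^1 b₁₄ , sym (ℤ.pos-* p a₁₄)
      above 1F 2F _ = a₂₃ , <p^3 b₂₃ , sym (ℤ.pos-* p a₂₃)
      above 1F 3F _ = a₂₄ , <p^3 b₂₄ , sym (ℤ.pos-* p a₂₄)
      above 2F 3F _ = 0 , s≤s z≤n , cong +_ (sym (ℕ.*-zeroʳ p))
      above 0F 0F ()
      above 1F 0F ()
      above 1F 1F (s≤s ())
      above 2F 0F ()
      above 2F 1F (s≤s ())
      above 2F 2F (s≤s (s≤s ()))
      above 3F 0F ()
      above 3F 1F (s≤s ())
      above 3F 2F (s≤s (s≤s ()))
      above 3F 3F (s≤s (s≤s (s≤s ())))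

    irreducible⇒shape : ∀ {A} → IsIrredSubringMatrix p 4 α A → ∃ λ q → InRange q × A ≡ matrixOf q
    irreducible⇒shape {A} irr
      with offDiagonal irr 0F 1F (s≤s z≤n) | offDiagonal irr 0F 2F (s≤s z≤n) | offDiagonal irr 0F 3F (s≤s z≤n)
         | offDiagonal irr 1F 2F (s≤s (s≤s z≤n)) | offDiagonal irr 1F 3F (s≤s (s≤s z≤n))
    ... | a₁₂ , b₁₂ , e₁₂ | a₁₃ , b₁₃ , e₁₃ | a₁₄ , b₁₄ , e₁₄ | a₂₃ , b₂₃ , e₂₃ | a₂₄ , b₂₄ , e₂₄ =
      (a₁₂ , a₁₃ , a₁₄ , a₂₃ , a₂₄) ,
      (<p^1⇒<p b₁₂ , <p^1⇒<p b₁₃ , <p^1⇒<p b₁₄ , <p^3⇒<p³ b₂₃ , <p^3⇒<p³ b₂₄) ,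
      entry-ext entries
      where
      <p^1⇒<p : ∀ {a} → a < p ^ 1 → a < p
      <p^1⇒<p {a} = subst (a <_) (ℕ.*-identityʳ p)
      <p^3⇒<p³ : ∀ {a} → a < p ^ 3 → a < p ℕ.* (p ℕ.* p)
      <p^3⇒<p³ {a} = subst (a <_) p^3≡
      value : ∀ {x a} → x ≡ + (p ℕ.* a) → x ≡ + p * + a
      value {a = a} x≡pa = trans x≡pa (ℤ.pos-* p a)
      below : ∀ i j {j<i : True (toℕ j ℕ.<? toℕ i)} → entry A i j ≡ + 0
      below i j {j<i} = upperTriangular irr i j (toWitness j<i)
      a₃₄≡0 : entry A 2F 3F ≡ + 0
      a₃₄≡0 with offDiagonal irr 2F 3F (s≤s (s≤s (s≤s z≤n)))
      ... | zero  , _      , e = trans e (cong +_ (ℕ.*-zeroʳ p))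
      ... | suc _ , s≤s () , _
      entries : ∀ i j → entry A i j ≡ entry (matrixOf (a₁₂ , a₁₃ , a₁₄ , a₂₃ , a₂₄)) i j
      entries 0F 0F = trans (diagonal irr 0F) +[p^2]≡+p*+p
      entries 0F 1F = value e₁₂
      entries 0F 2F = value e₁₃
      entries 0F 3F = value e₁₄
      entries 0F 4F = lastColumn irr 0F
      entries 1F 0F = below 1F 0F
      entries 1F 1F = trans (diagonal irr 1F) +[p^4]≡+p*+p*[+p*+p]
      entries 1F 2F = value e₂₃
      entries 1F 3F = value e₂₄
      entries 1F 4F = lastColumn irr 1F
      entries 2F 0F = below 2F 0F
      entries 2F 1F = below 2F 1F
      entries 2F 2F = trans (diagonal irr 2F) +[p^1]≡+p
      entries 2F 3F = a₃₄≡0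
      entries 2F 4F = lastColumn irr 2F
      entries 3F 0F = below 3F 0F
      entries 3F 1F = below 3F 1F
      entries 3F 2F = below 3F 2F
      entries 3F 3F = trans (diagonal irr 3F) +[p^2]≡+p*+p
      entries 3F 4F = lastColumn irr 3F
      entries 4F 0F = below 4F 0F
      entries 4F 1F = below 4F 1F
      entries 4F 2F = below 4F 2F
      entries 4F 3F = below 4F 3F
      entries 4F 4F = lastColumn irr 4F

module Enumeration {p : ℕ} (p-prime : Prime p) where

  open CandidateMatrices using (module Candidate)
  open NaturalConditions using (NatConditions; ClosureConditions⇔NatConditions)
  open AdmissibleTriples
  open IrreducibleMatrices
  open import Data.Nat as ℕ using (pred; NonZero)
  open import Data.Nat.Primality using (prime⇒nonZero)
  open import Data.Integer as ℤ using (+_)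
  import Data.Integer.Properties as ℤ
  open import Data.Fin.Patterns using (0F; 1F; 2F; 3F)
  open import Data.List using (List; map; cartesianProductWith; cartesianProduct; upTo; length)
  open import Data.List.Properties using (length-map; length-upTo)
  open import Data.List.Membership.Propositional using (_∈_)
  open import Data.List.Membership.Propositional.Properties
  open import Data.List.Relation.Unary.Unique.Propositional using (Unique)
  import Data.List.Relation.Unary.Unique.Propositional.Properties as Unique
  open import Data.Product using (_×_; _,_)
  open import Function.Bundles using (_⇔_; mk⇔; Equivalence)
  open import Function.Properties.Equivalence using () renaming (trans to ⇔-trans)
  open import Relation.Binary.PropositionalEquality

  private instance
    p≢0 : NonZero p
    p≢0 = prime⇒nonZero p-prime

  assemble : ℕ → ℕ × Triple → Quintuple
  assemble a₁₃ (a₁₄ , a₁₂ , a₂₃ , a₂₄) = a₁₂ , a₁₃ , a₁₄ , a₂₃ , a₂₄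

  quintuples : List Quintuple
  quintuples = cartesianProductWith assemble (upTo p) (cartesianProduct (upTo p) (admissibleTriples p))

  irreducibleMatrices : List (Matrix 5)
  irreducibleMatrices = map (matrixOf p) quintuples

  length-irreducibleMatrices :
    length irreducibleMatrices ≡ p ℕ.* (p ℕ.* (p ℕ.* (p ℕ.* p) ℕ.+ (p ℕ.* p ℕ.+ (pred p ℕ.* p ℕ.+ (pred p ℕ.* p ℕ.+ pred p)))))
  length-irreducibleMatrices =
    trans (length-map (matrixOf p) quintuples)
    (trans (length-cartesianProductWith assemble (upTo p) _)
    (cong₂ ℕ._*_ (length-upTo p)
      (trans (length-cartesianProductWith _,_ (upTo p) _)
        (cong₂ ℕ._*_ (length-upTo p) (length-admissibleTriples p)))))

  closed⇔conditions : ∀ a₁₂ a₁₃ a₁₄ a₂₃ a₂₄ →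
    ColSpanMulClosed (matrixOf p (a₁₂ , a₁₃ , a₁₄ , a₂₃ , a₂₄)) ⇔ NatConditions p a₁₂ a₂₃ a₂₄
  closed⇔conditions a₁₂ a₁₃ a₁₄ a₂₃ a₂₄ =
    ⇔-trans (Candidate.colSpanMulClosed⇔ClosureConditions (+ p) (+ a₁₂) (+ a₁₃) (+ a₁₄) (+ a₂₃) (+ a₂₄))
            (ClosureConditions⇔NatConditions p-prime a₁₂ a₂₃ a₂₄)

  ∈irreducibleMatrices⇔ : ∀ A → A ∈ irreducibleMatrices ⇔ IsIrredSubringMatrix p 4 α A
  ∈irreducibleMatrices⇔ A = mk⇔ to from
    where
    to : A ∈ irreducibleMatrices → IsIrredSubringMatrix p 4 α A
    to A∈ with ∈-map⁻ (matrixOf p) A∈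
    ... | q , q∈ , refl with ∈-cartesianProductWith⁻ assemble (upTo p) (cartesianProduct (upTo p) (admissibleTriples p)) q∈
    ... | a₁₃ , (a₁₄ , (a₁₂ , a₂₃ , a₂₄)) , a₁₃∈ , rest∈ , refl with ∈-cartesianProduct⁻ (upTo p) (admissibleTriples p) rest∈
    ... | a₁₄∈ , t∈ with Equivalence.to (∈admissibleTriples⇔Valid p-prime) t∈
    ... | (b₁₂ , b₂₃ , b₂₄) , conditions =
      shape⇒irreducible p (b₁₂ , ∈-upTo⁻ a₁₃∈ , ∈-upTo⁻ a₁₄∈ , b₂₃ , b₂₄)
        (Equivalence.from (closed⇔conditions a₁₂ a₁₃ a₁₄ a₂₃ a₂₄) conditions)
    from : IsIrredSubringMatrix p 4 α A → A ∈ irreducibleMatrices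
    from irr with irreducible⇒shape p irr
    ... | (a₁₂ , a₁₃ , a₁₄ , a₂₃ , a₂₄) , (b₁₂ , b₁₃ , b₁₄ , b₂₃ , b₂₄) , refl =
      ∈-map⁺ (matrixOf p) (∈-cartesianProductWith⁺ assemble (∈-upTo⁺ b₁₃) (∈-cartesianProduct⁺ (∈-upTo⁺ b₁₄)
        (Equivalence.from (∈admissibleTriples⇔Valid p-prime)
          ((b₁₂ , b₂₃ , b₂₄) , Equivalence.to (closed⇔conditions a₁₂ a₁₃ a₁₄ a₂₃ a₂₄) (IsIrredSubringMatrix.subring irr)))))

  unique-irreducibleMatrices : Unique irreducibleMatrices
  unique-irreducibleMatrices = Unique.map⁺ matrixOf-injective
    (Unique.cartesianProductWith⁺ assemble assemble-injective (Unique.upTo⁺ p)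
      (Unique.cartesianProduct⁺ (Unique.upTo⁺ p) (unique-admissibleTriples p-prime)))
    where
    assemble-injective : ∀ {w x y z} → assemble w y ≡ assemble x z → w ≡ x × y ≡ z
    assemble-injective {y = _ , _ , _ , _} {z = _ , _ , _ , _} refl = refl , refl
    entry-injective : ∀ {A B : Matrix 5} i j {a b} → A ≡ B → entry A i j ≡ + p ℤ.* + a → entry B i j ≡ + p ℤ.* + b → a ≡ b
    entry-injective i j {a} {b} refl Aij≡pa Aij≡pb = ℤ.+-injective (ℤ.*-cancelˡ-≡ (+ p) (+ a) (+ b) (trans (sym Aij≡pa) Aij≡pb))
    matrixOf-injective : ∀ {q q′} → matrixOf p q ≡ matrixOf p q′ → q ≡ q′
    matrixOf-injective {_ , _ , _ , _ , _} {_ , _ , _ , _ , _} e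
      with entry-injective 0F 1F e refl refl | entry-injective 0F 2F e refl refl | entry-injective 0F 3F e refl refl
         | entry-injective 1F 2F e refl refl | entry-injective 1F 3F e refl refl
    ... | refl | refl | refl | refl | refl = refl

module Counting where

  open IrreducibleMatrices using (pos-^)
  open import Data.Nat as ℕ using (suc; pred; NonZero)
  open import Data.Integer using (+_; _+_; _-_; _*_; _^_)
  import Data.Integer.Properties as ℤ
  import Data.Nat.Tactic.RingSolver as ℕ-Solver
  import Data.Integer.Tactic.RingSolver as ℤ-Solver
  open import Relation.Binary.PropositionalEquality using (_≡_; cong; cong₂; module ≡-Reasoning)

  count-identity : ∀ p .{{_ : NonZero p}} →
    + (p ℕ.* (p ℕ.* (p ℕ.* (p ℕ.* p) ℕ.+ (p ℕ.* p ℕ.+ (pred p ℕ.* p ℕ.+ (pred p ℕ.* p ℕ.+ pred p))))))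
      ≡ (+ p) ^ 5 + + 3 * (+ p) ^ 4 - (+ p) ^ 3 - (+ p) ^ 2
  count-identity p@(suc q) = begin
    + C                                                             ≡⟨ move (+ C) (+ (p ℕ.^ 3)) (+ (p ℕ.^ 2)) ⟩
    + C + (+ (p ℕ.^ 3) + + (p ℕ.^ 2)) - + (p ℕ.^ 3) - + (p ℕ.^ 2)   ≡⟨ cong (λ x → x - + (p ℕ.^ 3) - + (p ℕ.^ 2)) cast ⟩
    + (p ℕ.^ 5) + + 3 * + (p ℕ.^ 4) - + (p ℕ.^ 3) - + (p ℕ.^ 2)
      ≡⟨ cong₂ _-_ (cong₂ _-_ (cong₂ (λ a b → a + + 3 * b) (pos-^ p 5) (pos-^ p 4)) (pos-^ p 3)) (pos-^ p 2) ⟩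
    (+ p) ^ 5 + + 3 * (+ p) ^ 4 - (+ p) ^ 3 - (+ p) ^ 2             ∎
    where
    open ≡-Reasoning
    C : ℕ
    C = p ℕ.* (p ℕ.* (p ℕ.* (p ℕ.* p) ℕ.+ (p ℕ.* p ℕ.+ (q ℕ.* p ℕ.+ (q ℕ.* p ℕ.+ q)))))
    move : ∀ c a b → c ≡ c + (a + b) - a - b
    move = ℤ-Solver.solve-∀
    ℕ-identity : ∀ q → let p = 1 ℕ.+ q in
      p ℕ.* (p ℕ.* (p ℕ.* (p ℕ.* p) ℕ.+ (p ℕ.* p ℕ.+ (q ℕ.* p ℕ.+ (q ℕ.* p ℕ.+ q)))))
        ℕ.+ (p ℕ.* (p ℕ.* (p ℕ.* 1)) ℕ.+ p ℕ.* (p ℕ.* 1))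
        ≡ p ℕ.* (p ℕ.* (p ℕ.* (p ℕ.* (p ℕ.* 1)))) ℕ.+ 3 ℕ.* (p ℕ.* (p ℕ.* (p ℕ.* (p ℕ.* 1))))
    ℕ-identity = ℕ-Solver.solve-∀
    cast : + C + (+ (p ℕ.^ 3) + + (p ℕ.^ 2)) ≡ + (p ℕ.^ 5) + + 3 * + (p ℕ.^ 4)
    cast = begin
      + C + (+ (p ℕ.^ 3) + + (p ℕ.^ 2))  ≡⟨ cong (_+_ (+ C)) (ℤ.pos-+ (p ℕ.^ 3) (p ℕ.^ 2)) ⟨
      + C + + (p ℕ.^ 3 ℕ.+ p ℕ.^ 2)      ≡⟨ ℤ.pos-+ C (p ℕ.^ 3 ℕ.+ p ℕ.^ 2) ⟨
      + (C ℕ.+ (p ℕ.^ 3 ℕ.+ p ℕ.^ 2))    ≡⟨ cong +_ (ℕ-identity q) ⟩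
      + (p ℕ.^ 5 ℕ.+ 3 ℕ.* p ℕ.^ 4)      ≡⟨ ℤ.pos-+ (p ℕ.^ 5) (3 ℕ.* p ℕ.^ 4) ⟩
      + (p ℕ.^ 5) + + (3 ℕ.* p ℕ.^ 4)    ≡⟨ cong (_+_ (+ (p ℕ.^ 5))) (ℤ.pos-* 3 (p ℕ.^ 4)) ⟩
      + (p ℕ.^ 5) + + 3 * + (p ℕ.^ 4)    ∎

open Enumeration using (irreducibleMatrices; unique-irreducibleMatrices; ∈irreducibleMatrices⇔; length-irreducibleMatrices)
open Counting using (count-identity)
open import Data.Nat.Primality using (prime⇒nonZero)
open import Data.Integer using (+_; _+_; _-_; _*_; _^_)
open import Data.Vec using (_∷_; [])
open import Data.List using (List; length)
open import Data.List.Membership.Propositional using (_∈_)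
open import Data.List.Relation.Unary.Unique.Propositional using (Unique)
open import Data.Product using (Σ; _×_; _,_)
open import Function.Bundles using (_⇔_)
open import Relation.Binary.PropositionalEquality using (_≡_; cong; trans)

lemma4p2 : (p : ℕ) → Prime p →
    Σ (List (Matrix 5)) λ L →
    Unique L ×
    (∀ A → (A ∈ L) ⇔ IsIrredSubringMatrix p 4 (2 ∷ 4 ∷ 1 ∷ 2 ∷ []) A) ×
    (+ length L ≡ (+ p) ^ 5 + + 3 * (+ p) ^ 4 - (+ p) ^ 3 - (+ p) ^ 2)
lemma4p2 p p-prime =
  irreducibleMatrices p-prime , unique-irreducibleMatrices p-prime , ∈irreducibleMatrices⇔ p-prime ,
  trans (cong +_ (length-irreducibleMatrices p-prime)) (count-identity p {{prime⇒nonZero p-prime}})
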